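{- Let $\lambda=[\lambda_1,\dots,\lambda_m]$ be a partition (a composition with $\lambda_1\ge\lambda_2\ge\dots\ge\lambda_m$) and $s$ a positive integer. (i) If $\lambda_1<s$, then $\mathrm{Z}_{s,\lambda}=\emptyset$. (ii) If $\lambda_1=s$, then $\mathrm{Z}_{s,\lambda}=\{(s,0,\ldots,0)\}$. (iii) If $\lambda_1>s$, then $\mathrm{sgn}(\beta)=1$ for all $\beta\in\mathrm{Z}_{s,\lambda}$.
   Context: For $\beta\in\mathbb{Z}^m$, $\mathrm{sgn}(\beta)=(-1)^{\mathrm{neg}(\beta)}$ where $\mathrm{neg}(\beta)$ is the number of negative entries of $\beta$. For a composition $\alpha=[\alpha_1,\dots,\alpha_m]$ (tuple of positive integers) and $s>0$, $\mathrm{Z}_{s,\alpha}$ is the set of $\beta=(\beta_1,\dots,\beta_m)\in\mathbb{Z}^m$ such that: (Z1) $\beta_1+\dots+\beta_m=s$ and $\beta_1+\dots+\beta_i\le s$ for $i<m$; (Z2) $\alpha_i-\beta_i\ge0$ for all $1\le i\le m$, and $\alpha_i-\beta_i=0$ for at most one $i$; (Z3) for each $i\in\{1,\dots,m\}$, writing $t_i=s-(\beta_1+\dots+\beta_{i-1})$: (a) if $\alpha_i>t_i$ then $0\le\beta_i\le t_i$; (b) if $\alpha_i=t_i$ then either (1) $\beta_i=\alpha_i$ and $\beta_{i+1}=\dots=\beta_m=0$, or (2) $\beta_i<0$; (c) if $\alpha_i<t_i$ then $\beta_i<0$. -}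

module Defs where

open import Data.Nat as ℕ using (ℕ; zero; suc)
open import Data.Integer as ℤ using (ℤ; +_; _+_; _≤_; _<_; 0ℤ)
open import Data.Fin as Fin using (Fin; toℕ)
open import Data.Vec using (Vec; []; _∷_; lookup; map; replicate)
open import Data.Product using (_×_; ∃)
open import Data.Sum using (_⊎_)
open import Relation.Binary.PropositionalEquality using (_≡_; _≢_)
open import Relation.Nullary using (¬_)

IsComposition : ∀ {m} → Vec ℕ m → Set
IsComposition {m} α = ∀ (i : Fin m) → 0 ℕ.< lookup α i

IsPartition : ∀ {m} → Vec ℕ m → Set
IsPartition {m} λ' = IsComposition λ' ×
  (∀ (i j : Fin m) → toℕ i ℕ.≤ toℕ j → lookup λ' j ℕ.≤ lookup λ' i)

prefixSum : ∀ {m} → Vec ℤ m → ℕ → ℤ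
prefixSum []      _       = 0ℤ
prefixSum (x ∷ β) zero    = 0ℤ
prefixSum (x ∷ β) (suc i) = x + prefixSum β i

total : ∀ {m} → Vec ℤ m → ℤ
total {m} β = prefixSum β m

neg : ∀ {m} → Vec ℤ m → ℕ
neg []      = 0
neg (x ∷ β) with x ℤ.<? 0ℤ
... | Relation.Nullary.yes _ = suc (neg β)
... | Relation.Nullary.no  _ = neg β

sgn : ∀ {m} → Vec ℤ m → ℤ
sgn β = (ℤ.- ℤ.1ℤ) ℤ.^ neg β

-- Membership in Z_{s,α}.  Entries are indexed by i : Fin m (i.e. 0-based,
-- position toℕ i + 1 in the paper); t_i = s - (β_1 + ... + β_{i-1}).
module _ {m : ℕ} (s : ℕ) (α : Vec ℕ m) (β : Vec ℤ m) where
  private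
    a : Fin m → ℤ
    a i = + lookup α i
    b : Fin m → ℤ
    b i = lookup β i
    t : Fin m → ℤ
    t i = + s ℤ.- prefixSum β (toℕ i)

  Z1 : Set
  Z1 = total β ≡ + s × (∀ (i : ℕ) → i ℕ.< m → prefixSum β i ≤ + s)

  Z2 : Set
  Z2 = (∀ i → b i ≤ a i) ×
       (∀ i j → a i ≡ b i → a j ≡ b j → i ≡ j)

  Z3 : Set
  Z3 = ∀ (i : Fin m) →
         (t i < a i → 0ℤ ≤ b i × b i ≤ t i) ×
         (a i ≡ t i → (b i ≡ a i × (∀ (j : Fin m) → toℕ i ℕ.< toℕ j → b j ≡ 0ℤ))
                      ⊎ b i < 0ℤ) ×
         (a i < t i → b i < 0ℤ)

  InZ : Set
  InZ = Z1 × Z2 × Z3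

-- Let t_i = s − (β_1 + ⋯ + β_{i−1}) be the budget left at position i, so
-- t_1 = s and, by (Z1), t_{m+1} = 0.  If t_i > A for some A bounding all of
-- λ_i, …, λ_m, then (Z3c) forces β_i < 0, hence t_{i+1} > t_i > A; inductively
-- t_{m+1} > A ≥ 0, which is absurd.  For a partition, λ_i bounds all later
-- entries, so t_i ≤ λ_i for every i.  At i = 1 this is s ≤ λ_1, giving (i).
-- When t_i = λ_i, a negative β_i would give t_{i+1} > λ_i, so together with
-- (Z3a) every β_i is nonnegative, giving (iii); when λ_1 = s this excludes the
-- second alternative of (Z3b) at i = 1, leaving (s, 0, …, 0), giving (ii).
module Submission where

open import Defs
open import Data.Nat using (ℕ; suc; _<_; _>_)
open import Data.Integer using (ℤ; +_; 0ℤ; 1ℤ)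
open import Data.Vec using (Vec; _∷_; replicate)
open import Data.Product using (_×_)
open import Data.Empty using (⊥)
open import Relation.Binary.PropositionalEquality using (_≡_)

import Data.Nat as ℕ
import Data.Nat.Properties as ℕ
open import Data.Nat using (_≤‴_; ≤‴-refl; ≤‴-step; z≤n; s≤s)
open import Data.Integer as ℤ using (_+_; _-_; -_; _≮_; +≤+)
open import Data.Integer.Properties
  using (+-identityˡ; +-identityʳ; +-comm; +-assoc; +-inverseʳ; neg-distrib-+;
         +-monoʳ-<; neg-mono-<; +-injective; drop‿+≤+; <-cmp; <-irrefl; <-trans;
         ≤-<-trans; ≤-refl; ≤-reflexive; <⇒≱; ≮⇒≥; +≮0)
open import Data.Fin using (Fin; zero; suc; toℕ; fromℕ<)
open import Data.Fin.Properties using (toℕ-fromℕ<; toℕ<n)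
open import Data.Vec using ([]; lookup)
open import Data.Vec.Properties using (lookup-replicate)
open import Data.Product using (_,_; proj₁; proj₂)
open import Data.Sum using (inj₁; inj₂)
open import Data.Empty using (⊥-elim)
open import Function using (_∘_)
open import Relation.Binary.Definitions using (tri<; tri≈; tri>)
open import Relation.Binary.PropositionalEquality
  using (_≢_; refl; sym; trans; cong; subst; module ≡-Reasoning)
open import Relation.Nullary using (yes; no)

prefixSum-zero : ∀ {n} (β : Vec ℤ n) → prefixSum β 0 ≡ 0ℤ
prefixSum-zero []      = refl
prefixSum-zero (_ ∷ _) = refl

prefixSum-suc : ∀ {n} (β : Vec ℤ n) (j : Fin n) →
                prefixSum β (suc (toℕ j)) ≡ prefixSum β (toℕ j) + lookup β j
prefixSum-suc (x ∷ β) zero    rewrite prefixSum-zero β = +-comm x 0ℤ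
prefixSum-suc (x ∷ β) (suc j) rewrite prefixSum-suc β j =
  sym (+-assoc x (prefixSum β (toℕ j)) (lookup β j))

prefixSum-replicate-0 : ∀ m k → prefixSum (replicate m 0ℤ) k ≡ 0ℤ
prefixSum-replicate-0 ℕ.zero    k       = refl
prefixSum-replicate-0 (suc m) ℕ.zero  = refl
prefixSum-replicate-0 (suc m) (suc k) = trans (+-identityˡ _) (prefixSum-replicate-0 m k)

lookup-0⇒≡replicate : ∀ {m} (v : Vec ℤ m) → (∀ j → lookup v j ≡ 0ℤ) → v ≡ replicate m 0ℤ
lookup-0⇒≡replicate []      _ = refl
lookup-0⇒≡replicate (x ∷ v) h rewrite h zero | lookup-0⇒≡replicate v (h ∘ suc) = refl

i<i-j : ∀ i {j} → j ℤ.< 0ℤ → i ℤ.< i - j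
i<i-j i j<0 = subst (ℤ._< i - _) (+-identityʳ i) (+-monoʳ-< i (neg-mono-< j<0))

neg≡0 : ∀ {n} (β : Vec ℤ n) → (∀ j → 0ℤ ℤ.≤ lookup β j) → neg β ≡ 0
neg≡0 []      _   = refl
neg≡0 (x ∷ β) 0≤β with x ℤ.<? 0ℤ
... | yes x<0 = ⊥-elim (<⇒≱ x<0 (0≤β zero))
... | no  _   = neg≡0 β (0≤β ∘ suc)

-- budget s β (toℕ i) is definitionally the t used by Z3 at i.
budget : ∀ {n} → ℕ → Vec ℤ n → ℕ → ℤ
budget s β k = + s - prefixSum β k

budget-zero : ∀ {n} s (β : Vec ℤ n) → budget s β 0 ≡ + s
budget-zero s β rewrite prefixSum-zero β = +-identityʳ (+ s)

budget-suc : ∀ {n} s (β : Vec ℤ n) (j : Fin n) →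
             budget s β (suc (toℕ j)) ≡ budget s β (toℕ j) - lookup β j
budget-suc s β j = begin
  + s - prefixSum β (suc (toℕ j))  ≡⟨ cong (_-_ (+ s)) (prefixSum-suc β j) ⟩
  + s - (p + b)                    ≡⟨ cong (ℤ._+_ (+ s)) (neg-distrib-+ p b) ⟩
  + s + (- p - b)                  ≡⟨ sym (+-assoc (+ s) (- p) (- b)) ⟩
  + s - p - b                      ∎
  where
    open ≡-Reasoning
    p = prefixSum β (toℕ j)
    b = lookup β j

budget-total : ∀ {n s} (β : Vec ℤ n) → total β ≡ + s → budget s β n ≡ 0ℤ
budget-total {s = s} β total≡s rewrite total≡s = +-inverseʳ (+ s)

budget-rises : ∀ {n} s (β : Vec ℤ n) (j : Fin n) → lookup β j ℤ.< 0ℤ →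
               budget s β (toℕ j) ℤ.< budget s β (suc (toℕ j))
budget-rises s β j βj<0 =
  subst (budget s β (toℕ j) ℤ.<_) (sym (budget-suc s β j)) (i<i-j _ βj<0)

budget-rises-above : ∀ {n s A} (α : Vec ℕ n) β → Z3 s α β → ∀ j → lookup α j ℕ.≤ A →
                     + A ℤ.< budget s β (toℕ j) → + A ℤ.< budget s β (suc (toℕ j))
budget-rises-above {s = s} α β z3 j αj≤A A<t =
  <-trans A<t (budget-rises s β j (proj₂ (proj₂ (z3 j)) (≤-<-trans (+≤+ αj≤A) A<t)))

bound≮budget : ∀ {n s k A} (α : Vec ℕ n) β → total β ≡ + s → Z3 s α β → k ≤‴ n →
               (∀ j → k ℕ.≤ toℕ j → lookup α j ℕ.≤ A) → + A ≮ budget s β k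
bound≮budget {A = A} α β total≡s z3 ≤‴-refl _ A<t =
  +≮0 (subst (+ A ℤ.<_) (budget-total β total≡s) A<t)
bound≮budget α β total≡s z3 (≤‴-step k<n) bound A<t
  with fromℕ< (ℕ.≤‴⇒≤ k<n) | toℕ-fromℕ< (ℕ.≤‴⇒≤ k<n)
... | j | refl =
  bound≮budget α β total≡s z3 k<n (λ i j<i → bound i (ℕ.<⇒≤ j<i))
    (budget-rises-above α β z3 j (bound j ℕ.≤-refl) A<t)

partition-InZ⇒0≤ : ∀ {n s} (α : Vec ℕ n) β → IsPartition α → InZ s α β →
                   ∀ j → 0ℤ ℤ.≤ lookup β j
partition-InZ⇒0≤ {s = s} α β (_ , decreasing) ((total≡s , _) , _ , z3) j
  with <-cmp (budget s β (toℕ j)) (+ lookup α j)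
... | tri< t<αj _ _ = proj₁ (proj₁ (z3 j) t<αj)
... | tri> _ _ αj<t =
  ⊥-elim (bound≮budget α β total≡s z3 (ℕ.≤⇒≤‴ (ℕ.<⇒≤ (toℕ<n j))) (decreasing j) αj<t)
... | tri≈ _ t≡αj _ with proj₁ (proj₂ (z3 j)) (sym t≡αj)
...   | inj₁ (βj≡αj , _) = subst (0ℤ ℤ.≤_) (sym βj≡αj) (+≤+ z≤n)
...   | inj₂ βj<0 =
  ⊥-elim (bound≮budget α β total≡s z3 (ℕ.≤⇒≤‴ (toℕ<n j)) (λ i → decreasing j i ∘ ℕ.<⇒≤)
            (subst (ℤ._< budget s β (suc (toℕ j))) t≡αj (budget-rises s β j βj<0)))

sgn≡1 : ∀ {n} (β : Vec ℤ n) → (∀ j → 0ℤ ℤ.≤ lookup β j) → sgn β ≡ 1ℤ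
sgn≡1 β 0≤β = cong ((- 1ℤ) ℤ.^_) (neg≡0 β 0≤β)

InZ⇒s≤head : ∀ {m s l₁} {ls : Vec ℕ m} {β} → IsPartition (l₁ ∷ ls) → InZ s (l₁ ∷ ls) β →
             s ℕ.≤ l₁
InZ⇒s≤head {s = s} {l₁} {ls} {β} (_ , decreasing) ((total≡s , _) , _ , z3) =
  drop‿+≤+ (≮⇒≥ (subst (+ l₁ ≮_) (budget-zero s β)
    (bound≮budget (l₁ ∷ ls) β total≡s z3 ℕ.0≤‴n (λ i _ → decreasing zero i z≤n))))

InZ⇒≡head∷zeros : ∀ {m s} {ls : Vec ℕ m} {β} → IsPartition (s ∷ ls) → InZ s (s ∷ ls) β →
                  β ≡ + s ∷ replicate m 0ℤ
InZ⇒≡head∷zeros {s = s} {ls} {b ∷ bs} partition β∈Z@(_ , _ , z3)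
  with proj₁ (proj₂ (z3 zero)) (sym (budget-zero s (b ∷ bs)))
... | inj₁ (refl , later≡0) =
  cong (b ∷_) (lookup-0⇒≡replicate bs (λ j → later≡0 (suc j) (s≤s z≤n)))
... | inj₂ b<0 = ⊥-elim (<⇒≱ b<0 (partition-InZ⇒0≤ (s ∷ ls) (b ∷ bs) partition β∈Z zero))

head∷zeros∈Z : ∀ {m} s {ls : Vec ℕ m} → IsComposition ls → InZ s (s ∷ ls) (+ s ∷ replicate m 0ℤ)
head∷zeros∈Z {m} s {ls} positive =
  (prefixSum-head∷zeros m , prefix≤s) , (β≤α , at-most-one-equality) , z3
  where
    β : Vec ℤ (suc m)
    β = + s ∷ replicate m 0ℤ

    prefixSum-head∷zeros : ∀ k → prefixSum β (suc k) ≡ + s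
    prefixSum-head∷zeros k =
      trans (cong (ℤ._+_ (+ s)) (prefixSum-replicate-0 m k)) (+-identityʳ (+ s))

    budget-after-head : ∀ k → budget s β (suc k) ≡ 0ℤ
    budget-after-head k = trans (cong (_-_ (+ s)) (prefixSum-head∷zeros k)) (+-inverseʳ (+ s))

    ls≢0 : ∀ j → + lookup ls j ≢ 0ℤ
    ls≢0 j ls≡0 = ℕ.<⇒≢ (positive j) (sym (+-injective ls≡0))

    β-later : ∀ j → lookup β (suc j) ≡ 0ℤ
    β-later j = lookup-replicate j 0ℤ

    prefix≤s : ∀ i → i ℕ.< suc m → prefixSum β i ℤ.≤ + s
    prefix≤s ℕ.zero  _ = +≤+ z≤n
    prefix≤s (suc i) _ = ≤-reflexive (prefixSum-head∷zeros i)

    β≤α : ∀ i → lookup β i ℤ.≤ + lookup (s ∷ ls) i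
    β≤α zero    = ≤-refl
    β≤α (suc j) = subst (ℤ._≤ + lookup ls j) (sym (β-later j)) (+≤+ z≤n)

    at-most-one-equality : ∀ i j → + lookup (s ∷ ls) i ≡ lookup β i →
                           + lookup (s ∷ ls) j ≡ lookup β j → i ≡ j
    at-most-one-equality zero    zero    _ _ = refl
    at-most-one-equality (suc i) _       e _ = ⊥-elim (ls≢0 i (trans e (β-later i)))
    at-most-one-equality zero    (suc j) _ e = ⊥-elim (ls≢0 j (trans e (β-later j)))

    z3 : Z3 s (s ∷ ls) β
    z3 zero =
      (λ t<s → ⊥-elim (<-irrefl (budget-zero s β) t<s)) ,
      (λ _ → inj₁ (refl , λ { zero () ; (suc j) _ → β-later j })) ,
      (λ s<t → ⊥-elim (<-irrefl (sym (budget-zero s β)) s<t))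
    z3 (suc j) =
      (λ _ → ≤-reflexive (sym (β-later j)) , ≤-reflexive (trans (β-later j) (sym t≡0))) ,
      (λ α≡t → ⊥-elim (ls≢0 j (trans α≡t t≡0))) ,
      (λ α<t → ⊥-elim (+≮0 (subst (+ lookup ls j ℤ.<_) t≡0 α<t)))
      where
        t≡0 : budget s β (suc (toℕ j)) ≡ 0ℤ
        t≡0 = budget-after-head (toℕ j)

lemma4p5 : ∀ (m s : ℕ) (l₁ : ℕ) (ls : Vec ℕ m) → 0 < s → IsPartition (l₁ ∷ ls) →
    (l₁ < s → ∀ (β : Vec ℤ (suc m)) → InZ s (l₁ ∷ ls) β → ⊥) ×
    (l₁ ≡ s → ∀ (β : Vec ℤ (suc m)) → (InZ s (l₁ ∷ ls) β → β ≡ + s ∷ replicate m 0ℤ) × (β ≡ + s ∷ replicate m 0ℤ → InZ s (l₁ ∷ ls) β)) ×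
    (l₁ > s → ∀ (β : Vec ℤ (suc m)) → InZ s (l₁ ∷ ls) β → sgn β ≡ 1ℤ)
lemma4p5 m s l₁ ls _ partition =
  (λ l₁<s β β∈Z → ℕ.<⇒≱ l₁<s (InZ⇒s≤head {β = β} partition β∈Z)) ,
  (λ { refl β → InZ⇒≡head∷zeros {β = β} partition ,
                λ { refl → head∷zeros∈Z s (proj₁ partition ∘ suc) } }) ,
  (λ _ β β∈Z → sgn≡1 β (partition-InZ⇒0≤ (l₁ ∷ ls) β partition β∈Z))
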